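{- Let $T$ be a $\mathbf{B}$-derivation whose root is labeled by $X\Rightarrow A$, and let $\sigma$ be an $\mathsf{rseq}$-substitution. Then $\sigma^{\varepsilon}(T)$ is again a $\mathbf{B}$-derivation, and its root is labeled by $\sigma^{\varepsilon}(X)\Rightarrow\sigma^{\varepsilon}(A)$.
   Context: Language. Fix a countably infinite set of atoms $\mathsf{At}$. Formulas are built from atoms by $\neg$ and the binary connectives $\land,\lor,\to,\circ$. Bunches are built from formulas by two binary operations, comma $(X,Y)$ and semicolon $(X;Y)$. A consecution is $X\Rightarrow A$ with $X$ a bunch, $A$ a formula. The parsing tree of a bunch has it at the root; a node $X;Y$, $X,Y$, $A\land B$, $A\lor B$, $A\to B$, $A\circ B$ has children $X,Y$ (resp. $A,B$) in order, $\neg A$ has child $A$, atoms are leaves; occurrences of subexpressions are nodes. $Y(X)$ denotes $Y$ with a distinguished occurrence of a subbunch $X$; $Y(Z)$ replaces it by $Z$. Sequences. Let $\mathsf{seq}$ be the set of finite sequences over the alphabet $\{l,r,\lambda,\rho,n\}$, $\varepsilon$ the empty sequence, juxtaposition = concatenation. One-step reduction $\rightsquigarrow'$ is generated by: $\overline{x}l\lambda\overline{y}\rightsquigarrow'\overline{x}\rho\overline{y}$; $\overline{x}r\lambda\overline{y}\rightsquigarrow'\overline{x}\overline{y}$; $\overline{x}\lambda r\overline{y}\rightsquigarrow'\overline{x}\overline{y}$; $\overline{x}\rho r\overline{y}\rightsquigarrow'\overline{x}l\overline{y}$; $\overline{x}nn\overline{y}\rightsquigarrow'\overline{x}\overline{y}$.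 A sequence is reduced if no such step applies; $\mathsf{rseq}$ is the set of reduced sequences; $\rightsquigarrow$ is the reflexive-transitive closure of $\rightsquigarrow'$. Every $\overline{z}$ reduces to exactly one reduced sequence, denoted $\mathsf{red}(\overline{z})$. $\mathsf{rseq}$-annotation. Annotate the parsing tree of a bunch: root gets $\varepsilon$; if a node gets $\overline{x}$: for $X;Y$ and $A\circ B$ the left child gets $\mathsf{red}(\lambda\overline{x})$ and the right child $\mathsf{red}(\rho\overline{x})$; for $A\to B$, $A$ gets $\mathsf{red}(l\overline{x})$ and $B$ gets $\mathsf{red}(r\overline{x})$; for $\neg A$, $A$ gets $\mathsf{red}(n\overline{x})$; children of $X,Y$, $A\land B$, $A\lor B$ get $\overline{x}$. An occurrence falls under its annotation. $\mathsf{rseq}$-substitutions. A function $\sigma:\mathsf{rseq}\times\mathsf{At}\to$ formulas, written $\sigma^{\overline{x}}(p)$, extended to bunches by $\sigma^{\overline{x}}(A\land B)=\sigma^{\overline{x}}(A)\land\sigma^{\overline{x}}(B)$, $\sigma^{\overline{x}}(A\lor B)=\sigma^{\overline{x}}(A)\lor\sigma^{\overline{x}}(B)$, $\sigma^{\overline{x}}(\neg A)=\neg\sigma^{\mathsf{red}(n\overline{x})}(A)$, $\sigma^{\overline{x}}(A\to B)=\sigma^{\mathsf{red}(l\overline{x})}(A)\to\sigma^{\mathsf{red}(r\overline{x})}(B)$, $\sigma^{\overline{x}}(A\circ B)=\sigma^{\mathsf{red}(\lambda\overline{x})}(A)\circ\sigma^{\mathsf{red}(\rho\overline{x})}(B)$,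 $\sigma^{\overline{x}}(X,Y)=\sigma^{\overline{x}}(X),\sigma^{\overline{x}}(Y)$, $\sigma^{\overline{x}}(X;Y)=\sigma^{\mathsf{red}(\lambda\overline{x})}(X);\sigma^{\mathsf{red}(\rho\overline{x})}(Y)$. For $\overline{w},\overline{y}\in\mathsf{rseq}$, the $\mathsf{rseq}$-substitution $\sigma_{\overline{w}\mapsto\overline{y}}$ is given on atoms by $\sigma^{\overline{x}}_{\overline{w}\mapsto\overline{y}}(p)=\sigma^{\mathsf{red}(\overline{z}\overline{y})}(p)$ if $\overline{z}\overline{w}\rightsquigarrow\overline{x}$ for some $\overline{z}\in\mathsf{seq}$ (independent of the choice of $\overline{z}$), and $\sigma^{\overline{x}}(p)$ otherwise. Rules of $\mathbf{B}$ (premises in order / conclusion): (id): $A\Rightarrow A$, no premises. ($\to$I): $X;A\Rightarrow B$ / $X\Rightarrow A\to B$. ($\to$E): $X\Rightarrow A\to B$, $Y\Rightarrow A$ / $X;Y\Rightarrow B$. ($\lor$I$_1$): $X\Rightarrow A$ / $X\Rightarrow A\lor B$. ($\lor$I$_2$): $X\Rightarrow B$ / $X\Rightarrow A\lor B$. ($\lor$E): $X\Rightarrow A\lor B$, $Y(A)\Rightarrow C$, $Y(B)\Rightarrow C$ / $Y(X)\Rightarrow C$. ($\land$I): $X\Rightarrow A$, $Y\Rightarrow B$ / $X,Y\Rightarrow A\land B$. ($\land$E): $X\Rightarrow A\land B$, $Y(A,B)\Rightarrow C$ / $Y(X)\Rightarrow C$. ($\circ$I): $X\Rightarrow A$, $Y\Rightarrow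 B$ / $X;Y\Rightarrow A\circ B$. ($\circ$E): $X\Rightarrow A\circ B$, $Y(A;B)\Rightarrow C$ / $Y(X)\Rightarrow C$. ($\neg$I): $X\Rightarrow B$, $A\Rightarrow\neg B$ / $X\Rightarrow\neg A$. ($\neg$E): $X\Rightarrow\neg\neg A$ / $X\Rightarrow A$. (Cut): $X\Rightarrow A$, $Y(A)\Rightarrow B$ / $Y(X)\Rightarrow B$. Structural: (eB) $W(X,(Y,Z))\Rightarrow A$ / $W((X,Y),Z)\Rightarrow A$; (eC) $W(X,Y)\Rightarrow A$ / $W(Y,X)\Rightarrow A$; (eW) $W(X,X)\Rightarrow A$ / $W(X)\Rightarrow A$; (eK) $W(X)\Rightarrow A$ / $W(X,Y)\Rightarrow A$. Derivations. A $\mathbf{B}$-pseudoderivation is a finite tree of nodes labeled by consecutions or rule names, rooted at a consecution node, with consecution nodes adjacent only to rule nodes and a node for a rule with $k$ premises adjacent to exactly $k+1$ consecution nodes (conclusion below, premises above). A $\mathbf{B}$-derivation is a pseudoderivation with at least one rule node in which every rule node with its neighbours is an instance of its rule. Action on derivations. $\sigma^{\overline{x}}(T)$ is defined recursively: a single consecution node $X\Rightarrow A$ goes to $\sigma^{\overline{x}}(X)\Rightarrow\sigma^{\overline{x}}(A)$; the (id) derivation of $A\Rightarrow A$ goes to the (id) derivation of $\sigma^{\overline{x}}(A)\Rightarrow\sigma^{\overline{x}}(A)$; if $T$ ends with rule $R$, conclusion $X\Rightarrow A$ and premise subtrees $S_1,\dots,S_k$, then $\sigma^{\overline{x}}(T)$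 ends with $R$, conclusion $\sigma^{\overline{x}}(X)\Rightarrow\sigma^{\overline{x}}(A)$, and premise subtrees $(\sigma_{R_1})^{\overline{x}}(S_1),\dots,(\sigma_{R_k})^{\overline{x}}(S_k)$, where: $\sigma_{R_1}=\sigma_{\lambda\mapsto\varepsilon}$ for ($\to$I); $\sigma_{R_1}=\sigma_{\varepsilon\mapsto\lambda}$ and $\sigma_{R_2}=\sigma_{\varepsilon\mapsto\rho}$ for ($\to$E) and ($\circ$I); for ($\lor$E), ($\land$E), ($\circ$E), (Cut) with conclusion $Y(X)\Rightarrow C$, $\sigma_{R_1}=\sigma_{\varepsilon\mapsto\overline{x}_0}$ where $\overline{x}_0$ is the sequence under which the distinguished occurrence of $X$ in $Y(X)$ falls; $\sigma_{R_2}=\sigma_{n\mapsto\varepsilon}$ for ($\neg$I) (the premise $A\Rightarrow\neg B$); and $\sigma_{R_i}=\sigma$ for all other premises of all rules. -}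

module Defs where

open import Data.Nat using (ℕ)
open import Data.Fin using (Fin; zero; suc)
open import Data.List using (List; []; _∷_; _++_; _∷ʳ_; InitLast; initLast; _∷ʳ′_)
open import Data.List.Properties using (++-assoc; ++-identityʳ)
open import Data.Vec using (Vec; []; _∷_)
import Data.Vec as Vec
open import Data.Product using (Σ; _×_; _,_; proj₁; proj₂)
open import Data.Unit using (⊤; tt)
open import Data.Empty using (⊥)
open import Relation.Nullary using (¬_; Dec; yes; no)
open import Relation.Binary.PropositionalEquality using (_≡_; refl; sym; subst)
open import Relation.Binary.Construct.Closure.ReflexiveTransitive
  using (Star; ε; _◅_; _◅◅_)

At : Set
At = ℕ

infixr 30 _∧_ _∨_ _∘_
infixr 25 _⟶_
infixl 20 _,,_ _⨾_
infix 10 _⇒_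

data Fm : Set where
  atom : At → Fm
  ~_   : Fm → Fm
  _∧_  : Fm → Fm → Fm
  _∨_  : Fm → Fm → Fm
  _⟶_  : Fm → Fm → Fm
  _∘_  : Fm → Fm → Fm

data Bunch : Set where
  fm   : Fm → Bunch
  _,,_ : Bunch → Bunch → Bunch
  _⨾_ : Bunch → Bunch → Bunch

data Consec : Set where
  _⇒_ : Bunch → Fm → Consec

-- Bunches with one distinguished subbunch occurrence: Y(-)
data Ctx : Set where
  hole  : Ctx
  _,,ₗ_ : Ctx → Bunch → Ctx
  _,,ᵣ_ : Bunch → Ctx → Ctx
  _⨾ₗ_ : Ctx → Bunch → Ctx
  _⨾ᵣ_ : Bunch → Ctx → Ctx

plug : Ctx → Bunch → Bunch
plug hole      Z = Z
plug (C ,,ₗ Y) Z = plug C Z ,, Y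
plug (X ,,ᵣ C) Z = X ,, plug C Z
plug (C ⨾ₗ Y) Z = plug C Z ⨾ Y
plug (X ⨾ᵣ C) Z = X ⨾ plug C Z

data Letter : Set where
  l r lam rho n : Letter      -- lam = λ, rho = ρ

Seq : Set
Seq = List Letter

data Rule : Seq → Seq → Set where
  lλ : Rule (l ∷ lam ∷ []) (rho ∷ [])
  rλ : Rule (r ∷ lam ∷ []) []
  λr : Rule (lam ∷ r ∷ []) []
  ρr : Rule (rho ∷ r ∷ []) (l ∷ [])
  nn : Rule (n ∷ n ∷ []) []

data Step : Seq → Seq → Set where
  step : ∀ x y {u v} → Rule u v → Step (x ++ u ++ y) (x ++ v ++ y)

_↝_ : Seq → Seq → Set
_↝_ = Star Step

Reduced : Seq → Set
Reduced s = ∀ t → ¬ Step s t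

RSeq : Set
RSeq = Σ Seq Reduced

consRaw : Letter → Seq → Seq
consRaw l   (lam ∷ s) = rho ∷ s
consRaw r   (lam ∷ s) = s
consRaw lam (r ∷ s)   = s
consRaw rho (r ∷ s)   = l ∷ s
consRaw n   (n ∷ s)   = s
consRaw a   s         = a ∷ s

NoHead : Letter → Seq → Set
NoHead a []      = ⊤
NoHead a (b ∷ _) = ∀ {v} → ¬ Rule (a ∷ b ∷ []) v

cons-reduced′ : ∀ {a s s′ t} → Reduced s → NoHead a s → Step s′ t → s′ ≡ a ∷ s → ⊥
cons-reduced′ rs nh (step [] y lλ) refl = nh lλ
cons-reduced′ rs nh (step [] y rλ) refl = nh rλ
cons-reduced′ rs nh (step [] y λr) refl = nh λr
cons-reduced′ rs nh (step [] y ρr) refl = nh ρr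
cons-reduced′ rs nh (step [] y nn) refl = nh nn
cons-reduced′ rs nh (step (c ∷ x) y ru) refl = rs _ (step x y ru)

cons-reduced : ∀ {a s} → Reduced s → NoHead a s → Reduced (a ∷ s)
cons-reduced rs nh t st = cons-reduced′ rs nh st refl

tail-reduced : ∀ {a s} → Reduced (a ∷ s) → Reduced s
tail-reduced rs t (step x y ru) = rs _ (step (_ ∷ x) y ru)

headλ : ∀ {s} → Reduced (lam ∷ s) → NoHead rho s
headλ {[]} rs = tt
headλ {l ∷ s'} rs ()
headλ {r ∷ s'} rs ρr = rs _ (step [] s' λr)
headλ {lam ∷ s'} rs ()
headλ {rho ∷ s'} rs ()
headλ {n ∷ s'} rs ()

headr : ∀ {s} → Reduced (r ∷ s) → NoHead l s
headr {[]} rs = tt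
headr {l ∷ s'} rs ()
headr {r ∷ s'} rs ()
headr {lam ∷ s'} rs lλ = rs _ (step [] s' rλ)
headr {rho ∷ s'} rs ()
headr {n ∷ s'} rs ()

consRed : ∀ a s → Reduced s → Reduced (consRaw a s)
consRed l [] rs = cons-reduced {l} {[]} rs tt
consRed l (l ∷ s) rs = cons-reduced {l} {l ∷ s} rs (λ ())
consRed l (r ∷ s) rs = cons-reduced {l} {r ∷ s} rs (λ ())
consRed l (lam ∷ s) rs = cons-reduced (tail-reduced rs) (headλ rs)
consRed l (rho ∷ s) rs = cons-reduced {l} {rho ∷ s} rs (λ ())
consRed l (n ∷ s) rs = cons-reduced {l} {n ∷ s} rs (λ ())
consRed r [] rs = cons-reduced {r} {[]} rs tt
consRed r (l ∷ s) rs = cons-reduced {r} {l ∷ s} rs (λ ())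
consRed r (r ∷ s) rs = cons-reduced {r} {r ∷ s} rs (λ ())
consRed r (lam ∷ s) rs = tail-reduced rs
consRed r (rho ∷ s) rs = cons-reduced {r} {rho ∷ s} rs (λ ())
consRed r (n ∷ s) rs = cons-reduced {r} {n ∷ s} rs (λ ())
consRed lam [] rs = cons-reduced {lam} {[]} rs tt
consRed lam (l ∷ s) rs = cons-reduced {lam} {l ∷ s} rs (λ ())
consRed lam (r ∷ s) rs = tail-reduced rs
consRed lam (lam ∷ s) rs = cons-reduced {lam} {lam ∷ s} rs (λ ())
consRed lam (rho ∷ s) rs = cons-reduced {lam} {rho ∷ s} rs (λ ())
consRed lam (n ∷ s) rs = cons-reduced {lam} {n ∷ s} rs (λ ())
consRed rho [] rs = cons-reduced {rho} {[]} rs tt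
consRed rho (l ∷ s) rs = cons-reduced {rho} {l ∷ s} rs (λ ())
consRed rho (r ∷ s) rs = cons-reduced (tail-reduced rs) (headr rs)
consRed rho (lam ∷ s) rs = cons-reduced {rho} {lam ∷ s} rs (λ ())
consRed rho (rho ∷ s) rs = cons-reduced {rho} {rho ∷ s} rs (λ ())
consRed rho (n ∷ s) rs = cons-reduced {rho} {n ∷ s} rs (λ ())
consRed n [] rs = cons-reduced {n} {[]} rs tt
consRed n (l ∷ s) rs = cons-reduced {n} {l ∷ s} rs (λ ())
consRed n (r ∷ s) rs = cons-reduced {n} {r ∷ s} rs (λ ())
consRed n (lam ∷ s) rs = cons-reduced {n} {lam ∷ s} rs (λ ())
consRed n (rho ∷ s) rs = cons-reduced {n} {rho ∷ s} rs (λ ())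
consRed n (n ∷ s) rs = tail-reduced rs

cons-step : ∀ a s → Star Step (a ∷ s) (consRaw a s)
cons-step l [] = ε
cons-step l (l ∷ s) = ε
cons-step l (r ∷ s) = ε
cons-step l (lam ∷ s) = step [] s lλ ◅ ε
cons-step l (rho ∷ s) = ε
cons-step l (n ∷ s) = ε
cons-step r [] = ε
cons-step r (l ∷ s) = ε
cons-step r (r ∷ s) = ε
cons-step r (lam ∷ s) = step [] s rλ ◅ ε
cons-step r (rho ∷ s) = ε
cons-step r (n ∷ s) = ε
cons-step lam [] = ε
cons-step lam (l ∷ s) = ε
cons-step lam (r ∷ s) = step [] s λr ◅ ε
cons-step lam (lam ∷ s) = ε
cons-step lam (rho ∷ s) = ε
cons-step lam (n ∷ s) = ε
cons-step rho [] = ε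
cons-step rho (l ∷ s) = ε
cons-step rho (r ∷ s) = step [] s ρr ◅ ε
cons-step rho (lam ∷ s) = ε
cons-step rho (rho ∷ s) = ε
cons-step rho (n ∷ s) = ε
cons-step n [] = ε
cons-step n (l ∷ s) = ε
cons-step n (r ∷ s) = ε
cons-step n (lam ∷ s) = ε
cons-step n (rho ∷ s) = ε
cons-step n (n ∷ s) = step [] s nn ◅ ε

star-cons : ∀ {a s t} → s ↝ t → (a ∷ s) ↝ (a ∷ t)
star-cons ε = ε
star-cons (step x y ru ◅ st) = step (_ ∷ x) y ru ◅ star-cons st

redRaw : Seq → Seq
redRaw []      = []
redRaw (a ∷ s) = consRaw a (redRaw s)

redRaw-reduced : ∀ s → Reduced (redRaw s)
redRaw-reduced [] t st = nil st refl
  where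
  nil : ∀ {s′ t′} → Step s′ t′ → s′ ≡ [] → ⊥
  nil (step [] y lλ) ()
  nil (step [] y rλ) ()
  nil (step [] y λr) ()
  nil (step [] y ρr) ()
  nil (step [] y nn) ()
  nil (step (_ ∷ _) y ru) ()
redRaw-reduced (a ∷ s) = consRed a (redRaw s) (redRaw-reduced s)

red : Seq → RSeq
red s = redRaw s , redRaw-reduced s

red-reduces : ∀ s → s ↝ proj₁ (red s)
red-reduces []      = ε
red-reduces (a ∷ s) = star-cons (red-reduces s) ◅◅ cons-step a (redRaw s)

εR λR ρR nR : RSeq
εR = red []
λR = red (lam ∷ [])
ρR = red (rho ∷ [])
nR = red (n ∷ [])

_·_ : Letter → RSeq → RSeq
a · x = red (a ∷ proj₁ x)

Subst : Set
Subst = RSeq → At → Fm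

subF : Subst → RSeq → Fm → Fm
subF σ x (atom p) = σ x p
subF σ x (~ A)    = ~ subF σ (n · x) A
subF σ x (A ∧ B)  = subF σ x A ∧ subF σ x B
subF σ x (A ∨ B)  = subF σ x A ∨ subF σ x B
subF σ x (A ⟶ B)  = subF σ (l · x) A ⟶ subF σ (r · x) B
subF σ x (A ∘ B)  = subF σ (lam · x) A ∘ subF σ (rho · x) B

subB : Subst → RSeq → Bunch → Bunch
subB σ x (fm A)   = fm (subF σ x A)
subB σ x (X ,, Y) = subB σ x X ,, subB σ x Y
subB σ x (X ⨾ Y) = subB σ (lam · x) X ⨾ subB σ (rho · x) Y

subC : Subst → RSeq → Consec → Consec
subC σ x (X ⇒ A) = subB σ x X ⇒ subF σ x A

subCtx : Subst → RSeq → Ctx → Ctx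
subCtx σ x hole      = hole
subCtx σ x (C ,,ₗ Y) = subCtx σ x C ,,ₗ subB σ x Y
subCtx σ x (X ,,ᵣ C) = subB σ x X ,,ᵣ subCtx σ x C
subCtx σ x (C ⨾ₗ Y) = subCtx σ (lam · x) C ⨾ₗ subB σ (rho · x) Y
subCtx σ x (X ⨾ᵣ C) = subB σ (lam · x) X ⨾ᵣ subCtx σ (rho · x) C

-- the sequence under which the hole of Y(-) falls (annotation from ε at the root)
occAt : RSeq → Ctx → RSeq
occAt x hole      = x
occAt x (C ,,ₗ _) = occAt x C
occAt x (_ ,,ᵣ C) = occAt x C
occAt x (C ⨾ₗ _) = occAt (lam · x) C
occAt x (_ ⨾ᵣ C) = occAt (rho · x) C

occSeq : Ctx → RSeq
occSeq = occAt εR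

Reach : RSeq → RSeq → Set
Reach w x = Σ Seq λ z → (z ++ proj₁ w) ↝ proj₁ x

-- σ_{w̄ ↦ ȳ}, given a decision procedure for Reach w̄
shift : Subst → (w y : RSeq) → ((x : RSeq) → Dec (Reach w x)) → Subst
shift σ w y d x p with d x
... | yes (z , _) = σ (red (z ++ proj₁ y)) p
... | no  _       = σ x p

-- deciders for the three w̄ used below (in each case a witness always exists)
reachε : (x : RSeq) → Dec (Reach εR x)
reachε (x , _) = yes (x , subst (λ q → q ↝ x) (sym (++-identityʳ x)) ε)

private
  oneStep : ∀ {s t} → Step s t → s ↝ t
  oneStep st = st ◅ ε

  after : ∀ xs a b {v} → Rule (a ∷ b ∷ []) v → ((xs ++ a ∷ []) ++ b ∷ []) ↝ (xs ++ v)
  after xs a b {v} ru =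
    subst (λ q → q ↝ (xs ++ v)) (sym (++-assoc xs (a ∷ []) (b ∷ [])))
      (subst (λ q → (xs ++ a ∷ b ∷ []) ↝ (xs ++ q)) (++-identityʳ v)
        (subst (λ q → q ↝ (xs ++ v ++ [])) (cong′ (++-identityʳ (a ∷ b ∷ [])))
          (oneStep (step xs [] ru))))
    where
    cong′ : ∀ {p q : Seq} → p ≡ q → xs ++ p ≡ xs ++ q
    cong′ refl = refl

  after′ : ∀ xs a b → Rule (a ∷ b ∷ []) [] → ((xs ++ a ∷ []) ++ b ∷ []) ↝ xs
  after′ xs a b ru = subst (λ q → ((xs ++ a ∷ []) ++ b ∷ []) ↝ q) (++-identityʳ xs) (after xs a b ru)

reachλ : (x : RSeq) → Dec (Reach λR x)
reachλ (x , _) with initLast x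
... | []          = yes (r ∷ [] , oneStep (step [] [] rλ))
... | xs ∷ʳ′ l    = yes (xs ∷ʳ l ∷ʳ r , after′ (xs ∷ʳ l) r lam rλ)
... | xs ∷ʳ′ r    = yes (xs ∷ʳ r ∷ʳ r , after′ (xs ∷ʳ r) r lam rλ)
... | xs ∷ʳ′ lam  = yes (xs , ε)
... | xs ∷ʳ′ rho  = yes (xs ∷ʳ l , after xs l lam lλ)
... | xs ∷ʳ′ n    = yes (xs ∷ʳ n ∷ʳ r , after′ (xs ∷ʳ n) r lam rλ)

reachn : (x : RSeq) → Dec (Reach nR x)
reachn (x , _) with initLast x
... | []          = yes (n ∷ [] , oneStep (step [] [] nn))
... | xs ∷ʳ′ l    = yes (xs ∷ʳ l ∷ʳ n , after′ (xs ∷ʳ l) n n nn)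
... | xs ∷ʳ′ r    = yes (xs ∷ʳ r ∷ʳ n , after′ (xs ∷ʳ r) n n nn)
... | xs ∷ʳ′ lam  = yes (xs ∷ʳ lam ∷ʳ n , after′ (xs ∷ʳ lam) n n nn)
... | xs ∷ʳ′ rho  = yes (xs ∷ʳ rho ∷ʳ n , after′ (xs ∷ʳ rho) n n nn)
... | xs ∷ʳ′ n    = yes (xs , ε)

data RName : Set where
  idR →I →E ∨I₁ ∨I₂ ∨E ∧I ∧E ∘I ∘E ¬I ¬E Cut eB eC eW eK : RName

arity : RName → ℕ
arity idR = 0
arity →I  = 1
arity →E  = 2
arity ∨I₁ = 1
arity ∨I₂ = 1
arity ∨E  = 3
arity ∧I  = 2
arity ∧E  = 2
arity ∘I  = 2
arity ∘E  = 2
arity ¬I  = 2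
arity ¬E  = 1
arity Cut = 2
arity eB  = 1
arity eC  = 1
arity eW  = 1
arity eK  = 1

-- For the rules whose conclusion is Y(X) with a distinguished occurrence of X
-- (∨E, ∧E, ∘E, Cut) the rule node records that occurrence, i.e. the context Y(-).
Occ : RName → Set
Occ ∨E  = Ctx
Occ ∧E  = Ctx
Occ ∘E  = Ctx
Occ Cut = Ctx
Occ _   = ⊤

data Inst : (R : RName) → Occ R → Consec → Vec Consec (arity R) → Set where
  idI  : ∀ {A} → Inst idR tt (fm A ⇒ A) []
  →II  : ∀ {X A B} → Inst →I tt (X ⇒ A ⟶ B) ((X ⨾ fm A ⇒ B) ∷ [])
  →EI  : ∀ {X Y A B} → Inst →E tt (X ⨾ Y ⇒ B) ((X ⇒ A ⟶ B) ∷ (Y ⇒ A) ∷ [])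
  ∨I₁I : ∀ {X A B} → Inst ∨I₁ tt (X ⇒ A ∨ B) ((X ⇒ A) ∷ [])
  ∨I₂I : ∀ {X A B} → Inst ∨I₂ tt (X ⇒ A ∨ B) ((X ⇒ B) ∷ [])
  ∨EI  : ∀ {Y X A B C} → Inst ∨E Y (plug Y X ⇒ C)
           ((X ⇒ A ∨ B) ∷ (plug Y (fm A) ⇒ C) ∷ (plug Y (fm B) ⇒ C) ∷ [])
  ∧II  : ∀ {X Y A B} → Inst ∧I tt (X ,, Y ⇒ A ∧ B) ((X ⇒ A) ∷ (Y ⇒ B) ∷ [])
  ∧EI  : ∀ {Y X A B C} → Inst ∧E Y (plug Y X ⇒ C)
           ((X ⇒ A ∧ B) ∷ (plug Y (fm A ,, fm B) ⇒ C) ∷ [])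
  ∘II  : ∀ {X Y A B} → Inst ∘I tt (X ⨾ Y ⇒ A ∘ B) ((X ⇒ A) ∷ (Y ⇒ B) ∷ [])
  ∘EI  : ∀ {Y X A B C} → Inst ∘E Y (plug Y X ⇒ C)
           ((X ⇒ A ∘ B) ∷ (plug Y (fm A ⨾ fm B) ⇒ C) ∷ [])
  ¬II  : ∀ {X A B} → Inst ¬I tt (X ⇒ ~ A) ((X ⇒ B) ∷ (fm A ⇒ ~ B) ∷ [])
  ¬EI  : ∀ {X A} → Inst ¬E tt (X ⇒ A) ((X ⇒ ~ ~ A) ∷ [])
  CutI : ∀ {Y X A B} → Inst Cut Y (plug Y X ⇒ B) ((X ⇒ A) ∷ (plug Y (fm A) ⇒ B) ∷ [])
  eBI  : ∀ {W X Y Z A} → Inst eB tt (plug W ((X ,, Y) ,, Z) ⇒ A) ((plug W (X ,, (Y ,, Z)) ⇒ A) ∷ [])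
  eCI  : ∀ {W X Y A} → Inst eC tt (plug W (Y ,, X) ⇒ A) ((plug W (X ,, Y) ⇒ A) ∷ [])
  eWI  : ∀ {W X A} → Inst eW tt (plug W X ⇒ A) ((plug W (X ,, X) ⇒ A) ∷ [])
  eKI  : ∀ {W X Y A} → Inst eK tt (plug W (X ,, Y) ⇒ A) ((plug W X ⇒ A) ∷ [])

data Tree : Set where
  leaf : Consec → Tree
  node : (R : RName) → Occ R → Consec → Vec Tree (arity R) → Tree

label : Tree → Consec
label (leaf c)       = c
label (node _ _ c _) = c

mutual
  Valid : Tree → Set
  Valid (leaf _)        = ⊤
  Valid (node R o c ts) = Inst R o c (Vec.map label ts) × AllValid ts

  AllValid : ∀ {k} → Vec Tree k → Set
  AllValid []       = ⊤
  AllValid (t ∷ ts) = Valid t × AllValid ts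

HasRule : Tree → Set
HasRule (leaf _)       = ⊥
HasRule (node _ _ _ _) = ⊤

IsDerivation : Tree → Set
IsDerivation T = HasRule T × Valid T

subOcc : Subst → RSeq → (R : RName) → Occ R → Occ R
subOcc σ x ∨E  C = subCtx σ x C
subOcc σ x ∧E  C = subCtx σ x C
subOcc σ x ∘E  C = subCtx σ x C
subOcc σ x Cut C = subCtx σ x C
subOcc σ x idR o = o
subOcc σ x →I  o = o
subOcc σ x →E  o = o
subOcc σ x ∨I₁ o = o
subOcc σ x ∨I₂ o = o
subOcc σ x ∧I  o = o
subOcc σ x ∘I  o = o
subOcc σ x ¬I  o = o
subOcc σ x ¬E  o = o
subOcc σ x eB  o = o
subOcc σ x eC  o = o
subOcc σ x eW  o = o
subOcc σ x eK  o = o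

premSubst : (R : RName) → Occ R → Subst → Fin (arity R) → Subst
premSubst →I  _ σ zero       = shift σ λR εR reachλ
premSubst →E  _ σ zero       = shift σ εR λR reachε
premSubst →E  _ σ (suc zero) = shift σ εR ρR reachε
premSubst ∘I  _ σ zero       = shift σ εR λR reachε
premSubst ∘I  _ σ (suc zero) = shift σ εR ρR reachε
premSubst ∨E  C σ zero       = shift σ εR (occSeq C) reachε
premSubst ∧E  C σ zero       = shift σ εR (occSeq C) reachε
premSubst ∘E  C σ zero       = shift σ εR (occSeq C) reachε
premSubst Cut C σ zero       = shift σ εR (occSeq C) reachε
premSubst ¬I  _ σ (suc zero) = shift σ nR εR reachn
premSubst _   _ σ _          = σ

mutual
  act : Subst → RSeq → Tree → Tree
  act σ x (leaf c)        = leaf (subC σ x c)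
  act σ x (node R o c ts) = node R (subOcc σ x R o) (subC σ x c) (actV x (premSubst R o σ) ts)

  actV : ∀ {k} → RSeq → (Fin k → Subst) → Vec Tree k → Vec Tree k
  actV x f []       = []
  actV x f (t ∷ ts) = act (f zero) x t ∷ actV x (λ i → f (suc i)) ts

{-# OPTIONS --safe #-}
module Submission where

-- Every substitution σ_{R_i} that act attaches to a premise is a right translation of σ:
-- it reads σ at red(x̄ c̄) instead of at x̄, with c̄ = ȳ for σ_{ε↦ȳ}, and c̄ = r resp. n for
-- σ_{λ↦ε} resp. σ_{n↦ε} (λ and r, and n and n, cancel on either side). Since
-- red(s t) = red(red(s) t), prefixing a letter commutes with right translation, so the
-- translated substitution at x̄ agrees with σ at x̄ c̄ on every formula and bunch. Thus each
-- substituted premise is the premise substituted by σ at the annotation of its position in the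
-- rule, and every rule instance is preserved.

open import Defs
open import Data.Empty using (⊥-elim)
open import Data.List using ([]; _∷_; _++_; foldr)
open import Data.List.Properties using (++-assoc; ++-identityʳ)
open import Data.Product using (_×_; _,_; proj₁)
open import Data.Unit using (tt)
open import Data.Fin using (Fin; zero; suc)
open import Data.Vec using (Vec; []; _∷_)
import Data.Vec as Vec
open import Relation.Nullary using (Dec; yes; no)
open import Relation.Binary.PropositionalEquality
  using (_≡_; refl; sym; trans; cong; cong₂; subst; module ≡-Reasoning)
open import Relation.Binary.Construct.Closure.ReflexiveTransitive
  using (ε; _◅_; gmap)

reduced⇒noHead : ∀ {a s} → Reduced (a ∷ s) → NoHead a s
reduced⇒noHead {s = []}    _  = tt
reduced⇒noHead {s = _ ∷ s} rs = λ ru → rs _ (step [] s ru)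

consRaw-noHead : ∀ a s → NoHead a s → consRaw a s ≡ a ∷ s
consRaw-noHead l   []        _  = refl
consRaw-noHead l   (l ∷ s)   _  = refl
consRaw-noHead l   (r ∷ s)   _  = refl
consRaw-noHead l   (lam ∷ s) nh = ⊥-elim (nh lλ)
consRaw-noHead l   (rho ∷ s) _  = refl
consRaw-noHead l   (n ∷ s)   _  = refl
consRaw-noHead r   []        _  = refl
consRaw-noHead r   (l ∷ s)   _  = refl
consRaw-noHead r   (r ∷ s)   _  = refl
consRaw-noHead r   (lam ∷ s) nh = ⊥-elim (nh rλ)
consRaw-noHead r   (rho ∷ s) _  = refl
consRaw-noHead r   (n ∷ s)   _  = refl
consRaw-noHead lam []        _  = refl
consRaw-noHead lam (l ∷ s)   _  = refl
consRaw-noHead lam (r ∷ s)   nh = ⊥-elim (nh λr)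
consRaw-noHead lam (lam ∷ s) _  = refl
consRaw-noHead lam (rho ∷ s) _  = refl
consRaw-noHead lam (n ∷ s)   _  = refl
consRaw-noHead rho []        _  = refl
consRaw-noHead rho (l ∷ s)   _  = refl
consRaw-noHead rho (r ∷ s)   nh = ⊥-elim (nh ρr)
consRaw-noHead rho (lam ∷ s) _  = refl
consRaw-noHead rho (rho ∷ s) _  = refl
consRaw-noHead rho (n ∷ s)   _  = refl
consRaw-noHead n   []        _  = refl
consRaw-noHead n   (l ∷ s)   _  = refl
consRaw-noHead n   (r ∷ s)   _  = refl
consRaw-noHead n   (lam ∷ s) _  = refl
consRaw-noHead n   (rho ∷ s) _  = refl
consRaw-noHead n   (n ∷ s)   nh = ⊥-elim (nh nn)

consRaw-reduced : ∀ {a s} → Reduced (a ∷ s) → consRaw a s ≡ a ∷ s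
consRaw-reduced {a} {s} rs = consRaw-noHead a s (reduced⇒noHead rs)

redRaw-reduced-id : ∀ {s} → Reduced s → redRaw s ≡ s
redRaw-reduced-id {[]}    _  = refl
redRaw-reduced-id {a ∷ s} rs =
  trans (cong (consRaw a) (redRaw-reduced-id (tail-reduced rs))) (consRaw-reduced rs)

redRaw-idem : ∀ s → redRaw (redRaw s) ≡ redRaw s
redRaw-idem s = redRaw-reduced-id (redRaw-reduced s)

consRaw-rule : ∀ {a b v} → Rule (a ∷ b ∷ []) v →
               ∀ w → Reduced w → consRaw a (consRaw b w) ≡ foldr consRaw w v
consRaw-rule lλ []        _  = refl
consRaw-rule lλ (l ∷ w)   _  = refl
consRaw-rule lλ (r ∷ w)   rs = consRaw-noHead l w (headr rs)
consRaw-rule lλ (lam ∷ w) _  = refl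
consRaw-rule lλ (rho ∷ w) _  = refl
consRaw-rule lλ (n ∷ w)   _  = refl
consRaw-rule rλ []        _  = refl
consRaw-rule rλ (l ∷ w)   _  = refl
consRaw-rule rλ (r ∷ w)   rs = consRaw-reduced rs
consRaw-rule rλ (lam ∷ w) _  = refl
consRaw-rule rλ (rho ∷ w) _  = refl
consRaw-rule rλ (n ∷ w)   _  = refl
consRaw-rule λr []        _  = refl
consRaw-rule λr (l ∷ w)   _  = refl
consRaw-rule λr (r ∷ w)   _  = refl
consRaw-rule λr (lam ∷ w) rs = consRaw-reduced rs
consRaw-rule λr (rho ∷ w) _  = refl
consRaw-rule λr (n ∷ w)   _  = refl
consRaw-rule ρr []        _  = refl
consRaw-rule ρr (l ∷ w)   _  = refl
consRaw-rule ρr (r ∷ w)   _  = refl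
consRaw-rule ρr (lam ∷ w) rs = consRaw-noHead rho w (headλ rs)
consRaw-rule ρr (rho ∷ w) _  = refl
consRaw-rule ρr (n ∷ w)   _  = refl
consRaw-rule nn []        _  = refl
consRaw-rule nn (l ∷ w)   _  = refl
consRaw-rule nn (r ∷ w)   _  = refl
consRaw-rule nn (lam ∷ w) _  = refl
consRaw-rule nn (rho ∷ w) _  = refl
consRaw-rule nn (n ∷ w)   rs = consRaw-reduced rs

redRaw-step : ∀ {s t} → Step s t → redRaw s ≡ redRaw t
redRaw-step (step (a ∷ x) y ru) = cong (consRaw a) (redRaw-step (step x y ru))
redRaw-step (step [] y lλ) = consRaw-rule lλ (redRaw y) (redRaw-reduced y)
redRaw-step (step [] y rλ) = consRaw-rule rλ (redRaw y) (redRaw-reduced y)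
redRaw-step (step [] y λr) = consRaw-rule λr (redRaw y) (redRaw-reduced y)
redRaw-step (step [] y ρr) = consRaw-rule ρr (redRaw y) (redRaw-reduced y)
redRaw-step (step [] y nn) = consRaw-rule nn (redRaw y) (redRaw-reduced y)

redRaw-↝ : ∀ {s t} → s ↝ t → redRaw s ≡ redRaw t
redRaw-↝ ε          = refl
redRaw-↝ (st ◅ sts) = trans (redRaw-step st) (redRaw-↝ sts)

step-++ʳ : ∀ {s t} u → Step s t → Step (s ++ u) (t ++ u)
step-++ʳ u (step x y {p} {q} ru)
  rewrite ++-assoc x (p ++ y) u | ++-assoc p y u | ++-assoc x (q ++ y) u | ++-assoc q y u
  = step x (y ++ u) ru

↝-++ʳ : ∀ {s t} u → s ↝ t → (s ++ u) ↝ (t ++ u)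
↝-++ʳ u = gmap (_++ u) (step-++ʳ u)

redRaw-++-redRawˡ : ∀ s t → redRaw (s ++ t) ≡ redRaw (redRaw s ++ t)
redRaw-++-redRawˡ s t = redRaw-↝ (↝-++ʳ t (red-reduces s))

-- Reduced s is a function type into the stdlib's ⊥, a record with an irrelevant field, so any
-- two proofs of it are definitionally equal.
≡-rseq : {x y : RSeq} → proj₁ x ≡ proj₁ y → x ≡ y
≡-rseq refl = refl

red-proj₁ : (x : RSeq) → red (proj₁ x) ≡ x
red-proj₁ (s , rs) = ≡-rseq (redRaw-reduced-id rs)

infixl 5 _⋆_

_⋆_ : RSeq → Seq → RSeq
x ⋆ c = red (proj₁ x ++ c)

·-⋆ : ∀ a x c → a · (x ⋆ c) ≡ (a · x) ⋆ c
·-⋆ a x c = ≡-rseq (trans (cong (consRaw a) (redRaw-idem (proj₁ x ++ c)))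
                          (redRaw-++-redRawˡ (a ∷ proj₁ x) c))

_Translates_By_ : Subst → Subst → Seq → Set
σ′ Translates σ By c = ∀ x p → σ′ x p ≡ σ (x ⋆ c) p

module _ {σ σ′ : Subst} {c : Seq} (h : σ′ Translates σ By c) where

  subF-translate : ∀ x A → subF σ′ x A ≡ subF σ (x ⋆ c) A
  subF-translate x (atom p) = h x p
  subF-translate x (~ A) rewrite ·-⋆ n x c = cong ~_ (subF-translate (n · x) A)
  subF-translate x (A ∧ B) = cong₂ _∧_ (subF-translate x A) (subF-translate x B)
  subF-translate x (A ∨ B) = cong₂ _∨_ (subF-translate x A) (subF-translate x B)
  subF-translate x (A ⟶ B) rewrite ·-⋆ l x c | ·-⋆ r x c =
    cong₂ _⟶_ (subF-translate (l · x) A) (subF-translate (r · x) B)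
  subF-translate x (A ∘ B) rewrite ·-⋆ lam x c | ·-⋆ rho x c =
    cong₂ _∘_ (subF-translate (lam · x) A) (subF-translate (rho · x) B)

  subB-translate : ∀ x X → subB σ′ x X ≡ subB σ (x ⋆ c) X
  subB-translate x (fm A)   = cong fm (subF-translate x A)
  subB-translate x (X ,, Y) = cong₂ _,,_ (subB-translate x X) (subB-translate x Y)
  subB-translate x (X ⨾ Y) rewrite ·-⋆ lam x c | ·-⋆ rho x c =
    cong₂ _⨾_ (subB-translate (lam · x) X) (subB-translate (rho · x) Y)

shiftε-translates : ∀ σ y → shift σ εR y reachε Translates σ By proj₁ y
shiftε-translates σ y x p = refl

cancel-↝ : ∀ {a b} → Rule (a ∷ b ∷ []) [] → ∀ s → ((s ++ a ∷ []) ++ b ∷ []) ↝ s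
cancel-↝ {a} {b} ru s rewrite ++-assoc s (a ∷ []) (b ∷ []) =
  subst ((s ++ a ∷ b ∷ []) ↝_) (++-identityʳ s) (step s [] ru ◅ ε)

-- If z a ↝ x then z, z a b and x b have the same normal form; the no-branch is vacuous since
-- z = x b is always a witness.
shift-inverse-translates : ∀ {a b rw} → Rule (a ∷ b ∷ []) [] → Rule (b ∷ a ∷ []) [] →
  (d : ∀ x → Dec (Reach (a ∷ [] , rw) x)) → ∀ σ → shift σ (a ∷ [] , rw) εR d Translates σ By (b ∷ [])
shift-inverse-translates {a} {b} ab ba d σ x p with d x
... | yes (z , z·a↝x) = cong (λ y → σ y p) (≡-rseq (begin
  redRaw (z ++ [])                  ≡⟨ cong redRaw (++-identityʳ z) ⟩
  redRaw z                          ≡⟨ sym (redRaw-↝ (cancel-↝ ab z)) ⟩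
  redRaw ((z ++ a ∷ []) ++ b ∷ [])  ≡⟨ redRaw-↝ (↝-++ʳ (b ∷ []) z·a↝x) ⟩
  redRaw (proj₁ x ++ b ∷ [])        ∎))
  where open ≡-Reasoning
... | no ¬reach = ⊥-elim (¬reach (proj₁ x ++ b ∷ [] , cancel-↝ ba (proj₁ x)))

shiftλ-translates : ∀ σ → shift σ λR εR reachλ Translates σ By (r ∷ [])
shiftλ-translates = shift-inverse-translates λr rλ reachλ

shiftn-translates : ∀ σ → shift σ nR εR reachn Translates σ By (n ∷ [])
shiftn-translates = shift-inverse-translates nn nn reachn

subB-plug : ∀ σ x C Z → subB σ x (plug C Z) ≡ plug (subCtx σ x C) (subB σ (occAt x C) Z)
subB-plug σ x hole      Z = refl
subB-plug σ x (C ,,ₗ Y) Z = cong (_,, subB σ x Y) (subB-plug σ x C Z)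
subB-plug σ x (Y ,,ᵣ C) Z = cong (subB σ x Y ,,_) (subB-plug σ x C Z)
subB-plug σ x (C ⨾ₗ Y) Z = cong (_⨾ subB σ (rho · x) Y) (subB-plug σ (lam · x) C Z)
subB-plug σ x (Y ⨾ᵣ C) Z = cong (subB σ (lam · x) Y ⨾_) (subB-plug σ (rho · x) C Z)

subC-shiftε : ∀ σ y c → subC (shift σ εR y reachε) εR c ≡ subC σ y c
subC-shiftε σ y (X ⇒ A) = begin
  subB σ′ εR X ⇒ subF σ′ εR A
    ≡⟨ cong₂ _⇒_ (subB-translate h εR X) (subF-translate h εR A) ⟩
  subB σ (red (proj₁ y)) X ⇒ subF σ (red (proj₁ y)) A
    ≡⟨ cong (λ x → subB σ x X ⇒ subF σ x A) (red-proj₁ y) ⟩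
  subB σ y X ⇒ subF σ y A
    ∎
  where
  open ≡-Reasoning
  σ′ : Subst
  σ′ = shift σ εR y reachε
  h : σ′ Translates σ By proj₁ y
  h = shiftε-translates σ y

subPremises : ∀ {k} → (Fin k → Subst) → Vec Consec k → Vec Consec k
subPremises f []       = []
subPremises f (p ∷ ps) = subC (f zero) εR p ∷ subPremises (λ i → f (suc i)) ps

inst-sub : ∀ σ {R o c ps} → Inst R o c ps →
           Inst R (subOcc σ εR R o) (subC σ εR c) (subPremises (premSubst R o σ) ps)
inst-sub σ idI = idI
inst-sub σ (→II {X} {A} {B})
  rewrite subB-translate (shiftλ-translates σ) λR X
        | subF-translate (shiftλ-translates σ) ρR A
        | subF-translate (shiftλ-translates σ) εR B = →II
inst-sub σ (→EI {X} {Y} {A} {B})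
  rewrite subC-shiftε σ λR (X ⇒ A ⟶ B) | subC-shiftε σ ρR (Y ⇒ A) = →EI
inst-sub σ ∨I₁I = ∨I₁I
inst-sub σ ∨I₂I = ∨I₂I
inst-sub σ (∨EI {Y} {X} {A} {B})
  rewrite subB-plug σ εR Y X | subB-plug σ εR Y (fm A) | subB-plug σ εR Y (fm B)
        | subC-shiftε σ (occSeq Y) (X ⇒ A ∨ B) = ∨EI
inst-sub σ ∧II = ∧II
inst-sub σ (∧EI {Y} {X} {A} {B})
  rewrite subB-plug σ εR Y X | subB-plug σ εR Y (fm A ,, fm B)
        | subC-shiftε σ (occSeq Y) (X ⇒ A ∧ B) = ∧EI
inst-sub σ (∘II {X} {Y} {A} {B})
  rewrite subC-shiftε σ λR (X ⇒ A) | subC-shiftε σ ρR (Y ⇒ B) = ∘II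
inst-sub σ (∘EI {Y} {X} {A} {B})
  rewrite subB-plug σ εR Y X | subB-plug σ εR Y (fm A ⨾ fm B)
        | subC-shiftε σ (occSeq Y) (X ⇒ A ∘ B) = ∘EI
inst-sub σ (¬II {X} {A} {B})
  rewrite subF-translate (shiftn-translates σ) εR A
        | subF-translate (shiftn-translates σ) nR B = ¬II
inst-sub σ ¬EI = ¬EI
inst-sub σ (CutI {Y} {X} {A})
  rewrite subB-plug σ εR Y X | subB-plug σ εR Y (fm A)
        | subC-shiftε σ (occSeq Y) (X ⇒ A) = CutI
inst-sub σ (eBI {W} {X} {Y} {Z})
  rewrite subB-plug σ εR W ((X ,, Y) ,, Z) | subB-plug σ εR W (X ,, (Y ,, Z)) = eBI
inst-sub σ (eCI {W} {X} {Y})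
  rewrite subB-plug σ εR W (Y ,, X) | subB-plug σ εR W (X ,, Y) = eCI
inst-sub σ (eWI {W} {X})
  rewrite subB-plug σ εR W X | subB-plug σ εR W (X ,, X) = eWI
inst-sub σ (eKI {W} {X} {Y})
  rewrite subB-plug σ εR W (X ,, Y) | subB-plug σ εR W X = eKI

label-act : ∀ σ x T → label (act σ x T) ≡ subC σ x (label T)
label-act σ x (leaf c)       = refl
label-act σ x (node _ _ c _) = refl

labels-actV : ∀ {k} (f : Fin k → Subst) ts → Vec.map label (actV εR f ts) ≡ subPremises f (Vec.map label ts)
labels-actV f []       = refl
labels-actV f (t ∷ ts) = cong₂ _∷_ (label-act (f zero) εR t) (labels-actV (λ i → f (suc i)) ts)

hasRule-act : ∀ σ x T → HasRule T → HasRule (act σ x T)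
hasRule-act σ x (node _ _ _ _) _ = tt

mutual
  valid-act : ∀ σ T → Valid T → Valid (act σ εR T)
  valid-act σ (leaf c)        _        = tt
  valid-act σ (node R o c ts) (i , vs) =
    subst (Inst R (subOcc σ εR R o) (subC σ εR c)) (sym (labels-actV (premSubst R o σ) ts)) (inst-sub σ i) ,
    allValid-actV (premSubst R o σ) ts vs

  allValid-actV : ∀ {k} (f : Fin k → Subst) ts → AllValid ts → AllValid (actV εR f ts)
  allValid-actV f []       _        = tt
  allValid-actV f (t ∷ ts) (v , vs) = valid-act (f zero) t v , allValid-actV (λ i → f (suc i)) ts vs

theorem38 : (T : Tree) (X : Bunch) (A : Fm) (σ : Subst) →
    IsDerivation T → label T ≡ (X ⇒ A) →
    IsDerivation (act σ εR T) × label (act σ εR T) ≡ (subB σ εR X ⇒ subF σ εR A)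
theorem38 T X A σ (hasRule , valid) root =
  (hasRule-act σ εR T hasRule , valid-act σ T valid) ,
  trans (label-act σ εR T) (cong (subC σ εR) root)
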